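{- In the bridge-burning game on the grid $G_{m,n}$, if there exists a vertex $v$ of degree 2 or 3 such that no cop starts within distance 5 of $v$, then the robber can win.
   Context: Bridge-burning Cops and Robbers is played on a finite graph $G$ by a team of cops and a single robber, with full information. First each cop chooses a starting vertex (several cops may share a vertex), then the robber chooses a starting vertex. The game then proceeds in rounds; in each round, first every cop either stays put or moves along an edge of the current graph to an adjacent vertex, and then the robber either stays put or moves along an edge of the current graph. Every edge traversed by the robber is immediately deleted from the graph (cop moves delete nothing). The cops win if at some moment some cop occupies the same vertex as the robber; the robber wins if he avoids this forever. The grid $G_{m,n}=P_n\,\Box\,P_m$ has vertex set $\{(i,j):0\le i\le n-1,\ 0\le j\le m-1\}$ with $(i,j)$ adjacent to $(i',j')$ iff $|i-i'|+|j-j'|=1$. Distances refer to the original graph. -}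

module Defs where

open import Data.Nat using (ℕ; zero; suc; _+_; _≤_; ∣_-_∣)
open import Data.Fin using (Fin; toℕ)
open import Data.Product using (Σ; ∃; ∃-syntax; _×_; _,_)
open import Data.Sum using (_⊎_)
open import Data.List using (List; []; _∷_; length; filter; concatMap; map)
open import Data.List.Base using (allFin)
open import Data.List.Membership.Propositional using (_∈_)
open import Relation.Nullary using (¬_; Dec)
open import Relation.Binary.PropositionalEquality using (_≡_; _≢_)
open import Data.Nat.Properties using (_≟_)

-- The grid G_{m,n} = P_n □ P_m : vertices (i , j) with i < n, j < m.

Vertex : ℕ → ℕ → Set
Vertex m n = Fin n × Fin m

Adj : ∀ {m n} → Vertex m n → Vertex m n → Set
Adj (i , j) (i' , j') = ∣ toℕ i - toℕ i' ∣ + ∣ toℕ j - toℕ j' ∣ ≡ 1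

adj? : ∀ {m n} (u v : Vertex m n) → Dec (Adj u v)
adj? (i , j) (i' , j') = (∣ toℕ i - toℕ i' ∣ + ∣ toℕ j - toℕ j' ∣) ≟ 1

vertices : (m n : ℕ) → List (Vertex m n)
vertices m n = concatMap (λ i → map (λ j → (i , j)) (allFin m)) (allFin n)

degree : ∀ {m n} → Vertex m n → ℕ
degree {m} {n} v = length (filter (adj? v) (vertices m n))

-- Graph distance in the ORIGINAL grid: Within d u v means there is a
-- walk of length at most d from u to v, i.e. dist(u,v) ≤ d.
data Within {m n : ℕ} : ℕ → Vertex m n → Vertex m n → Set where
  here : ∀ {d u} → Within d u u
  step : ∀ {d u w v} → Adj u w → Within d w v → Within (suc d) u v

-- The bridge-burning game.
-- The current graph is the original grid minus a list D of deleted
-- (unordered) edges, each recorded as an ordered pair.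

Deleted : ∀ {m n} → List (Vertex m n × Vertex m n) → Vertex m n → Vertex m n → Set
Deleted D u v = (u , v) ∈ D ⊎ (v , u) ∈ D

Edge : ∀ {m n} → List (Vertex m n × Vertex m n) → Vertex m n → Vertex m n → Set
Edge D u v = Adj u v × ¬ Deleted D u v

-- A game position with the cops to move: current deleted edges,
-- positions of the k cops, position of the robber.
record Position (m n k : ℕ) : Set where
  constructor pos
  field
    deleted : List (Vertex m n × Vertex m n)
    cops    : Fin k → Vertex m n
    robber  : Vertex m n

NotCaught : ∀ {m n k} → (Fin k → Vertex m n) → Vertex m n → Set
NotCaught c r = ∀ i → c i ≢ r

CopMove : ∀ {m n k} → List (Vertex m n × Vertex m n) →
          (Fin k → Vertex m n) → (Fin k → Vertex m n) → Set
CopMove D c c' = ∀ i → c' i ≡ c i ⊎ Edge D (c i) (c' i)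

RobberMove : ∀ {m n} → List (Vertex m n × Vertex m n) → Vertex m n →
             Vertex m n → List (Vertex m n × Vertex m n) → Set
RobberMove D r r' D' =
  (r' ≡ r × D' ≡ D) ⊎ (Edge D r r' × D' ≡ (r , r') ∷ D)

-- A robber-safe set of positions (positions with the cops to move):
-- in every position of W the robber is not caught, and whatever legal
-- move the cops make, the robber is not caught by it and has a legal
-- reply leading to a position again in W.  (This is the coinductive
-- notion "the robber can avoid capture forever from here".)
RobberSafe : ∀ {m n k} → (Position m n k → Set) → Set
RobberSafe {m} {n} {k} W =
  ∀ D c r → W (pos D c r) →
    NotCaught c r ×
    (∀ (c' : Fin k → Vertex m n) → CopMove D c c' →
       NotCaught c' r ×
       ∃[ r' ] ∃[ D' ] (RobberMove D r r' D' × W (pos D' c' r')))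

RobberWins : ∀ {m n k} → (Fin k → Vertex m n) → Set₁
RobberWins {m} {n} {k} c₀ =
  Σ (Position m n k → Set) λ W → RobberSafe W × ∃[ r₀ ] W (pos [] c₀ r₀)

module Submission where

-- The robber picks a walk of at most five steps that starts near v,
-- burns every edge it uses, and ends at a "hideout" all of whose edges are then
-- burnt.  Cops starting farther than 5 from v can never catch up: in round t they
-- are still farther than 5 - t from v while the robber is within 4 - t, and in the
-- last round they cannot enter the hideout.
-- Escape routes are found in small grids (a square circuit near a corner of
-- G_{2,2}, a zigzag along a side of G_{2,3}) and moved into G_{m,n} by `transfer`
-- along Manhattan isometries ("embeddings") whose image contains all neighbours of
-- the hideout; transposition and mirroring move them from the bottom row to the
-- other sides.  Finally a vertex of degree 2 or 3 lies on the boundary, because an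
-- interior vertex is the centre of a 3 × 3 window and so has four neighbours.

open import Defs
open import Data.Nat using (ℕ; zero; suc; _+_; _∸_; _≤_; _<_; ∣_-_∣; z≤n; s≤s; _≟_)
open import Data.Nat.Properties
  using ( m≤n⇒m<n∨m≡n; ≤-<-trans; <-≤-trans; ≤-refl; ≤-pred; suc-injective; 0≢1+n; ≤∧≢⇒<; <⇒≱
        ; ∣m-n∣≡0⇒m≡n; ∣n-n∣≡0; m+n≡0⇒m≡0; m+n≡0⇒n≡0; ∣m+n-m+o∣≡∣n-o∣; +-comm; +-monoˡ-<
        ; m≤n⇒∣n-m∣≡n∸m; m∸n≤m; m∸[m∸n]≡n; ∣-∣-comm; n∸n≡0 )
open import Data.Fin using (Fin; toℕ; fromℕ<; opposite; #_) renaming (zero to fz; suc to fs)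
open import Data.Fin.Properties
  using (toℕ-injective; toℕ-fromℕ<; toℕ<n; opposite-prop; opposite-involutive; injective⇒≤)
import Data.Fin as Fin
open import Data.Product using (_×_; _,_; proj₁; proj₂; ∃-syntax)
import Data.Product as Product
open import Data.Product.Properties using (≡-dec)
open import Data.Sum using (_⊎_; inj₁; inj₂)
open import Data.List using (List; []; _∷_; filter; lookup; allFin)
import Data.List as List
open import Data.List.Membership.Propositional using (_∈_)
open import Data.List.Membership.Propositional.Properties
  using (∈-map⁺; ∈-map⁻; ∈-concatMap⁺; ∈-filter⁺; ∈-allFin)
import Data.List.Membership.DecPropositional as DecMembership
import Data.List.Relation.Unary.Any as Any
open import Data.List.Relation.Unary.Any.Properties using (lookup-index)
open import Data.Empty using (⊥-elim)
open import Function using (_∘_)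
open import Function.Definitions using (Injective)
open import Relation.Nullary using (¬_; Dec; yes; no)
open import Relation.Nullary.Decidable using (True; False; toWitness; toWitnessFalse; _⊎-dec_)
open import Relation.Binary.PropositionalEquality
  using (_≡_; _≢_; refl; sym; trans; cong; cong₂; subst; module ≡-Reasoning)

private
  variable
    m n k m₀ n₀ d e t : ℕ
    u v w : Vertex m n
    D : List (Vertex m n × Vertex m n)

CopStep : List (Vertex m n × Vertex m n) → Vertex m n → Vertex m n → Set
CopStep D u w = w ≡ u ⊎ Edge D u w

within-suc : Within d u v → Within (suc d) u v
within-suc here = here
within-suc (step adj h) = step adj (within-suc h)

approach : CopStep D u w → Within d w v → Within (suc d) u v
approach (inj₁ refl) h = within-suc h
approach (inj₂ (adj , _)) h = step adj h

∸-pred : t < d → d ∸ t ≡ suc (d ∸ suc t)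
∸-pred {zero} {suc d} _ = refl
∸-pred {suc t} {suc d} (s≤s t<d) = ∸-pred t<d

burnt : (ℕ → Vertex m n) → ℕ → List (Vertex m n × Vertex m n)
burnt walk zero = []
burnt walk (suc t) = (walk t , walk (suc t)) ∷ burnt walk t

-- An escape route against cops starting farther than d from v: in rounds
-- 0 … last the robber walks along fresh edges while staying strictly closer to
-- v than any cop can be, and then sits at the hideout walk (suc last), all of
-- whose edges he has burnt.  `guarded` says that no cop can enter the hideout
-- in the last round without having been within d ∸ last of v before it.
record EscapeRoute {m n : ℕ} (d : ℕ) (v : Vertex m n) : Set where
  field
    last     : ℕ
    walk     : ℕ → Vertex m n
    short    : last < d
    fresh    : ∀ t → t ≤ last → Edge (burnt walk t) (walk t) (walk (suc t))
    near     : ∀ t → t ≤ last → Within (d ∸ suc t) (walk t) v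
    guarded  : ∀ u → CopStep (burnt walk last) u (walk (suc last)) → Within (d ∸ last) u v
    isolated : ∀ u → Adj u (walk (suc last)) → Deleted (burnt walk (suc last)) u (walk (suc last))

  hideout : Vertex m n
  hideout = walk (suc last)

module _ {v : Vertex m n} (R : EscapeRoute d v) {k : ℕ} where
  open EscapeRoute R

  data Guarded : Position m n k → Set where
    walking : ∀ {t c} → t ≤ last → (∀ i → ¬ Within (d ∸ t) (c i) v) →
              Guarded (pos (burnt walk t) c (walk t))
    hidden  : ∀ {c} → (∀ i → c i ≢ hideout) →
              Guarded (pos (burnt walk (suc last)) c hideout)

  -- Since t ≤ last < d, one unit of slack separates the radii of rounds t and t + 1.
  widen : t ≤ last → Within (suc (d ∸ suc t)) u v → Within (d ∸ t) u v
  widen {u = u} t≤last = subst (λ e → Within e u v) (sym (∸-pred (≤-<-trans t≤last short)))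

  still-far : t ≤ last → ¬ Within (d ∸ t) u v → CopStep D u w → ¬ Within (d ∸ suc t) w v
  still-far t≤last far move = far ∘ widen t≤last ∘ approach move

  -- The robber at walk t is within d ∸ suc t of v, so a cop farther away misses him.
  misses : t ≤ last → ¬ Within (d ∸ suc t) u v → u ≢ walk t
  misses t≤last far refl = far (near _ t≤last)

  guarded-safe : RobberSafe Guarded
  guarded-safe _ c _ (walking {t} t≤last far) =
      (λ i → misses t≤last (far i ∘ widen t≤last ∘ within-suc))
    , λ c' moves →
        (λ i → misses t≤last (still-far t≤last (far i) (moves i)))
      , walk (suc t) , burnt walk (suc t) , inj₂ (fresh t t≤last , refl) , advance c' moves
    where
    -- After the last step of the walk, `guarded` keeps every cop off the hideout.
    advance : ∀ c' → CopMove (burnt walk t) c c' → Guarded (pos (burnt walk (suc t)) c' (walk (suc t)))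
    advance c' moves with m≤n⇒m<n∨m≡n t≤last
    ... | inj₁ t<last = walking t<last (λ i → still-far t≤last (far i) (moves i))
    ... | inj₂ refl = hidden λ i caught →
          far i (guarded (c i) (subst (CopStep _ (c i)) caught (moves i)))
  guarded-safe _ c _ (hidden away) =
    away , λ c' moves →
      stuck c' moves , hideout , burnt walk (suc last) , inj₁ (refl , refl) , hidden (stuck c' moves)
    where
    -- Every edge at the hideout is burnt, so no cop can step onto it.
    stuck : ∀ c' → CopMove (burnt walk (suc last)) c c' → ∀ i → c' i ≢ hideout
    stuck c' moves i caught with moves i
    ... | inj₁ stay = away i (trans (sym stay) caught)
    ... | inj₂ (adj , unburnt) =
          unburnt (subst (Deleted _ (c i)) (sym caught) (isolated (c i) (subst (Adj (c i)) caught adj)))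

  escape-wins : (c₀ : Fin k → Vertex m n) → (∀ i → ¬ Within d (c₀ i) v) → RobberWins c₀
  escape-wins c₀ far = Guarded , guarded-safe , walk 0 , walking z≤n far

col row : Vertex m n → ℕ
col = toℕ ∘ proj₁
row = toℕ ∘ proj₂

-- Manhattan distance; `Adj u w` unfolds to `manhattan u w ≡ 1`.
manhattan : Vertex m n → Vertex m n → ℕ
manhattan u w = ∣ col u - col w ∣ + ∣ row u - row w ∣

manhattan-self : (u : Vertex m n) → manhattan u u ≡ 0
manhattan-self u = cong₂ _+_ (∣n-n∣≡0 (col u)) (∣n-n∣≡0 (row u))

manhattan-zero : manhattan u w ≡ 0 → u ≡ w
manhattan-zero {u = u} {w} eq =
  cong₂ _,_ (toℕ-injective (∣m-n∣≡0⇒m≡n (m+n≡0⇒m≡0 ∣ col u - col w ∣ eq)))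
            (toℕ-injective (∣m-n∣≡0⇒m≡n (m+n≡0⇒n≡0 ∣ col u - col w ∣ eq)))

unit-gap : ∀ a b → ∣ a - b ∣ ≡ 1 → a ≡ suc b ⊎ suc a ≡ b
unit-gap zero (suc zero) _ = inj₂ refl
unit-gap (suc zero) zero _ = inj₁ refl
unit-gap (suc a) (suc b) eq with unit-gap a b eq
... | inj₁ up = inj₁ (cong suc up)
... | inj₂ down = inj₂ (cong suc down)

neighbour : Adj u w →
  (col u ≡ col w × (row u ≡ suc (row w) ⊎ suc (row u) ≡ row w)) ⊎
  (row u ≡ row w × (col u ≡ suc (col w) ⊎ suc (col u) ≡ col w))
neighbour {u = u} {w} adj with ∣ col u - col w ∣ in dc | ∣ row u - row w ∣ in dr
... | zero | _ = inj₁ (∣m-n∣≡0⇒m≡n dc , unit-gap (row u) (row w) (trans dr adj))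
... | suc zero | zero = inj₂ (∣m-n∣≡0⇒m≡n dr , unit-gap (col u) (col w) dc)

record Embedding (m₀ n₀ m n : ℕ) : Set where
  field
    ι        : Vertex m₀ n₀ → Vertex m n
    isometry : ∀ p q → manhattan (ι p) (ι q) ≡ manhattan p q

  injective : ∀ {p q} → ι p ≡ ι q → p ≡ q
  injective {p} {q} eq = manhattan-zero (begin
    manhattan p q         ≡⟨ sym (isometry p q) ⟩
    manhattan (ι p) (ι q) ≡⟨ cong (manhattan (ι p)) (sym eq) ⟩
    manhattan (ι p) (ι p) ≡⟨ manhattan-self (ι p) ⟩
    0                     ∎)
    where open ≡-Reasoning

  adj⁺ : ∀ {p q} → Adj p q → Adj (ι p) (ι q)
  adj⁺ {p} {q} = trans (isometry p q)

  adj⁻ : ∀ {p q} → Adj (ι p) (ι q) → Adj p q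
  adj⁻ {p} {q} = trans (sym (isometry p q))

  within⁺ : ∀ {p q} → Within e p q → Within e (ι p) (ι q)
  within⁺ here = here
  within⁺ (step adj h) = step (adj⁺ adj) (within⁺ h)

  burnt-image : (walk : ℕ → Vertex m₀ n₀) → ∀ t →
                burnt (ι ∘ walk) t ≡ List.map (Product.map ι ι) (burnt walk t)
  burnt-image walk zero = refl
  burnt-image walk (suc t) = cong (_ ∷_) (burnt-image walk t)

  image-∈⁻ : ∀ {D p q} → (ι p , ι q) ∈ List.map (Product.map ι ι) D → (p , q) ∈ D
  image-∈⁻ {D} pq with ∈-map⁻ (Product.map ι ι) pq
  ... | _ , ab∈D , eq =
    subst (_∈ D) (sym (cong₂ _,_ (injective (cong proj₁ eq)) (injective (cong proj₂ eq)))) ab∈D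

  burnt⁺ : ∀ walk t {p q} → Deleted (burnt walk t) p q → Deleted (burnt (ι ∘ walk) t) (ι p) (ι q)
  burnt⁺ walk t del rewrite burnt-image walk t with del
  ... | inj₁ pq = inj₁ (∈-map⁺ (Product.map ι ι) pq)
  ... | inj₂ qp = inj₂ (∈-map⁺ (Product.map ι ι) qp)

  burnt⁻ : ∀ walk t {p q} → Deleted (burnt (ι ∘ walk) t) (ι p) (ι q) → Deleted (burnt walk t) p q
  burnt⁻ walk t del rewrite burnt-image walk t with del
  ... | inj₁ pq = inj₁ (image-∈⁻ pq)
  ... | inj₂ qp = inj₂ (image-∈⁻ qp)

  FullAt : Vertex m₀ n₀ → Set
  FullAt c = ∀ u → Adj u (ι c) → ∃[ p ] u ≡ ι p

open Embedding

-- Escape routes move along embeddings that are full at the hideout: every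
-- condition on a cop near the hideout concerns a neighbour of it, hence a
-- vertex of the image, where it holds because it holds in the small grid.
transfer : (E : Embedding m₀ n₀ m n) (R : EscapeRoute d v) →
           FullAt E (EscapeRoute.hideout R) → EscapeRoute d (ι E v)
transfer {d = d} {v = v} E R full = record
  { last = last
  ; walk = ι E ∘ walk
  ; short = short
  ; fresh = λ t t≤last → let (adj , unburnt) = fresh t t≤last in
                         adj⁺ E adj , unburnt ∘ burnt⁻ E walk t
  ; near = λ t t≤last → within⁺ E (near t t≤last)
  ; guarded = guarded′
  ; isolated = isolated′
  }
  where
  open EscapeRoute R
  -- A cop entering the image hideout comes from an image vertex along an image edge.
  guarded′ : ∀ u → CopStep (burnt (ι E ∘ walk) last) u (ι E hideout) → Within (d ∸ last) u (ι E v)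
  guarded′ u (inj₁ refl) = within⁺ E (guarded hideout (inj₁ refl))
  guarded′ u (inj₂ (adj , unburnt)) with full u adj
  ... | p , refl = within⁺ E (guarded p (inj₂ (adj⁻ E adj , unburnt ∘ burnt⁺ E walk last)))
  isolated′ : ∀ u → Adj u (ι E hideout) → Deleted (burnt (ι E ∘ walk) (suc last)) u (ι E hideout)
  isolated′ u adj with full u adj
  ... | p , refl = burnt⁺ E walk (suc last) (isolated p (adj⁻ E adj))

along : (E : Embedding m₀ n₀ m n) → (∀ u → ∃[ p ] u ≡ ι E p) →
        EscapeRoute d v → EscapeRoute d (ι E v)
along E onto R = transfer E R (λ u _ → onto u)

transpose : Embedding m n n m
transpose = record
  { ι = λ (i , j) → j , i
  ; isometry = λ p q → +-comm ∣ row p - row q ∣ ∣ col p - col q ∣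
  }

transpose-onto : (u : Vertex n m) → ∃[ p ] u ≡ ι (transpose {m} {n}) p
transpose-onto (i , j) = (j , i) , refl

reflect-dist : ∀ K a b → a ≤ K → b ≤ K → ∣ K ∸ a - K ∸ b ∣ ≡ ∣ a - b ∣
reflect-dist K zero zero _ _ = ∣n-n∣≡0 K
reflect-dist K zero (suc b) _ b≤K =
  trans (m≤n⇒∣n-m∣≡n∸m (m∸n≤m K (suc b))) (m∸[m∸n]≡n b≤K)
reflect-dist K (suc a) zero a≤K _ =
  trans (∣-∣-comm (K ∸ suc a) K) (trans (m≤n⇒∣n-m∣≡n∸m (m∸n≤m K (suc a))) (m∸[m∸n]≡n a≤K))
reflect-dist (suc K) (suc a) (suc b) (s≤s a≤K) (s≤s b≤K) = reflect-dist K a b a≤K b≤K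

opposite-dist : (j j' : Fin m) → ∣ toℕ (opposite j) - toℕ (opposite j') ∣ ≡ ∣ toℕ j - toℕ j' ∣
opposite-dist {suc K} j j' rewrite opposite-prop j | opposite-prop j' =
  reflect-dist K (toℕ j) (toℕ j') (≤-pred (toℕ<n j)) (≤-pred (toℕ<n j'))

mirror : Embedding m n m n
mirror = record
  { ι = λ (i , j) → i , opposite j
  ; isometry = λ p q → cong (∣ col p - col q ∣ +_) (opposite-dist (proj₂ p) (proj₂ q))
  }

mirror-involutive : (u : Vertex m n) → ι mirror (ι mirror u) ≡ u
mirror-involutive (i , j) = cong (i ,_) (opposite-involutive j)

mirror-onto : (u : Vertex m n) → ∃[ p ] u ≡ ι mirror p
mirror-onto u = ι mirror u , sym (mirror-involutive u)

shift : ∀ {N K} (o : ℕ) → K + o ≤ N → Fin K → Fin N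
shift o fits a = fromℕ< (<-≤-trans (+-monoˡ-< o (toℕ<n a)) fits)

toℕ-shift : ∀ {N K} o (fits : K + o ≤ N) (a : Fin K) → toℕ (shift o fits a) ≡ toℕ a + o
toℕ-shift o fits a = toℕ-fromℕ< _

shift-dist : ∀ {N K} o (fits : K + o ≤ N) (a b : Fin K) →
             ∣ toℕ (shift o fits a) - toℕ (shift o fits b) ∣ ≡ ∣ toℕ a - toℕ b ∣
shift-dist o fits a b = begin
  ∣ toℕ (shift o fits a) - toℕ (shift o fits b) ∣ ≡⟨ cong₂ ∣_-_∣ (toℕ-shift o fits a) (toℕ-shift o fits b) ⟩
  ∣ toℕ a + o - toℕ b + o ∣                       ≡⟨ cong₂ ∣_-_∣ (+-comm (toℕ a) o) (+-comm (toℕ b) o) ⟩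
  ∣ o + toℕ a - o + toℕ b ∣                       ≡⟨ ∣m+n-m+o∣≡∣n-o∣ o (toℕ a) (toℕ b) ⟩
  ∣ toℕ a - toℕ b ∣                               ∎
  where open ≡-Reasoning

module Window (x y : ℕ) (fits-col : n₀ + x ≤ n) (fits-row : m₀ + y ≤ m) where

  window : Embedding m₀ n₀ m n
  window = record
    { ι = λ (a , b) → shift x fits-col a , shift y fits-row b
    ; isometry = λ p q → cong₂ _+_ (shift-dist x fits-col (proj₁ p) (proj₁ q))
                                   (shift-dist y fits-row (proj₂ p) (proj₂ q))
    }

  col-window : ∀ a b → col (ι window (a , b)) ≡ toℕ a + x
  col-window a b = toℕ-shift x fits-col a

  row-window : ∀ a b → row (ι window (a , b)) ≡ toℕ b + y
  row-window a b = toℕ-shift y fits-row b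

  placed : ∀ {u : Vertex m n} {a b} → col u ≡ toℕ a + x → row u ≡ toℕ b + y → u ≡ ι window (a , b)
  placed {a = a} {b} cu ru =
    cong₂ _,_ (toℕ-injective (trans cu (sym (col-window a b))))
              (toℕ-injective (trans ru (sym (row-window a b))))

-- Whether an edge has been deleted is decidable; on the explicit small grids
-- below the decision computes, which settles the bookkeeping of burnt edges.
deleted? : (D : List (Vertex m n × Vertex m n)) (u w : Vertex m n) → Dec (Deleted D u w)
deleted? D u w = ((u , w) ∈? D) ⊎-dec ((w , u) ∈? D)
  where open DecMembership (≡-dec (≡-dec Fin._≟_ Fin._≟_) (≡-dec Fin._≟_ Fin._≟_)) using (_∈?_)

burnt! : ∀ {D} {u w : Vertex m n} {ok : True (deleted? D u w)} → Deleted D u w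
burnt! {ok = ok} = toWitness ok

unburnt! : ∀ {D} {u w : Vertex m n} {ok : False (deleted? D u w)} → ¬ Deleted D u w
unburnt! {ok = ok} = toWitnessFalse ok

-- The robber circles the square G_{2,2}: (0,0) → (1,0) → (1,1) → (0,1) → (0,0),
-- burning all four edges and hiding in the corner (0,0).
circuit : ℕ → Vertex 2 2
circuit 0 = # 0 , # 0
circuit 1 = # 1 , # 0
circuit 2 = # 1 , # 1
circuit 3 = # 0 , # 1
circuit _ = # 0 , # 0

circuit-route : (v : Vertex 2 2) →
  (∀ t → t ≤ 3 → Within (5 ∸ suc t) (circuit t) v) →
  (∀ u → CopStep (burnt circuit 3) u (circuit 4) → Within 2 u v) →
  EscapeRoute 5 v
circuit-route v near guarded = record
  { last = 3 ; walk = circuit ; short = s≤s (s≤s (s≤s (s≤s z≤n)))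
  ; fresh = fresh ; near = near ; guarded = guarded ; isolated = isolated }
  where
  fresh : ∀ t → t ≤ 3 → Edge (burnt circuit t) (circuit t) (circuit (suc t))
  fresh 0 _ = refl , unburnt!
  fresh 1 _ = refl , unburnt!
  fresh 2 _ = refl , unburnt!
  fresh 3 _ = refl , unburnt!
  fresh (suc (suc (suc (suc _)))) (s≤s (s≤s (s≤s ())))
  isolated : ∀ u → Adj u (circuit 4) → Deleted (burnt circuit 4) u (circuit 4)
  isolated (fz , fs fz) _ = burnt!
  isolated (fs fz , fz) _ = burnt!

corner-route : EscapeRoute 5 (# 0 , # 0)
corner-route = circuit-route _ near guarded
  where
  near : ∀ t → t ≤ 3 → Within (5 ∸ suc t) (circuit t) (# 0 , # 0)
  near 0 _ = here
  near 1 _ = step refl here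
  near 2 _ = step {w = # 1 , # 0} refl (step refl here)
  near 3 _ = step refl here
  near (suc (suc (suc (suc _)))) (s≤s (s≤s (s≤s ())))
  guarded : ∀ u → CopStep (burnt circuit 3) u (circuit 4) → Within 2 u (# 0 , # 0)
  guarded _ (inj₁ refl) = here
  guarded (fz , fs fz) (inj₂ _) = step refl here
  guarded (fs fz , fz) (inj₂ (_ , unburnt)) = ⊥-elim (unburnt burnt!)

corner-neighbour-route : EscapeRoute 5 (# 0 , # 1)
corner-neighbour-route = circuit-route _ near guarded
  where
  near : ∀ t → t ≤ 3 → Within (5 ∸ suc t) (circuit t) (# 0 , # 1)
  near 0 _ = step refl here
  near 1 _ = step {w = # 1 , # 1} refl (step refl here)
  near 2 _ = step refl here
  near 3 _ = here
  near (suc (suc (suc (suc _)))) (s≤s (s≤s (s≤s ())))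
  guarded : ∀ u → CopStep (burnt circuit 3) u (circuit 4) → Within 2 u (# 0 , # 1)
  guarded _ (inj₁ refl) = step refl here
  guarded (fz , fs fz) (inj₂ _) = here
  guarded (fs fz , fz) (inj₂ (_ , unburnt)) = ⊥-elim (unburnt burnt!)

-- On a side, G_{2,3}: the robber runs (0,0) → (1,0) → (1,1) → (2,1) → (2,0) → (1,0)
-- and hides at (1,0); this escapes from cops far from (2,0).
zigzag : ℕ → Vertex 2 3
zigzag 0 = # 0 , # 0
zigzag 1 = # 1 , # 0
zigzag 2 = # 1 , # 1
zigzag 3 = # 2 , # 1
zigzag 4 = # 2 , # 0
zigzag _ = # 1 , # 0

side-route : EscapeRoute 5 (# 2 , # 0)
side-route = record
  { last = 4 ; walk = zigzag ; short = ≤-refl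
  ; fresh = fresh ; near = near ; guarded = guarded ; isolated = isolated }
  where
  fresh : ∀ t → t ≤ 4 → Edge (burnt zigzag t) (zigzag t) (zigzag (suc t))
  fresh 0 _ = refl , unburnt!
  fresh 1 _ = refl , unburnt!
  fresh 2 _ = refl , unburnt!
  fresh 3 _ = refl , unburnt!
  fresh 4 _ = refl , unburnt!
  fresh (suc (suc (suc (suc (suc _))))) (s≤s (s≤s (s≤s (s≤s ()))))
  near : ∀ t → t ≤ 4 → Within (5 ∸ suc t) (zigzag t) (# 2 , # 0)
  near 0 _ = step {w = # 1 , # 0} refl (step refl here)
  near 1 _ = step refl here
  near 2 _ = step {w = # 2 , # 1} refl (step refl here)
  near 3 _ = step refl here
  near 4 _ = here
  near (suc (suc (suc (suc (suc _))))) (s≤s (s≤s (s≤s (s≤s ()))))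
  guarded : ∀ u → CopStep (burnt zigzag 4) u (zigzag 5) → Within 1 u (# 2 , # 0)
  guarded _ (inj₁ refl) = step refl here
  guarded (fs (fs fz) , fz) (inj₂ _) = here
  guarded (fz , fz) (inj₂ (_ , unburnt)) = ⊥-elim (unburnt burnt!)
  guarded (fs fz , fs fz) (inj₂ (_ , unburnt)) = ⊥-elim (unburnt burnt!)
  isolated : ∀ u → Adj u (zigzag 5) → Deleted (burnt zigzag 5) u (zigzag 5)
  isolated (fz , fz) _ = burnt!
  isolated (fs (fs fz) , fz) _ = burnt!
  isolated (fs fz , fs fz) _ = burnt!

module _ (hn : 2 ≤ n) (hm : 2 ≤ m) where
  open Window 0 0 hn hm

  corner-full : Embedding.FullAt window (# 0 , # 0)
  corner-full u adj with neighbour {u = u} adj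
  ... | inj₁ (same , inj₁ above) =
        (# 0 , # 1) , placed (trans same (col-window (# 0) (# 0))) (trans above (cong suc (row-window (# 0) (# 0))))
  ... | inj₁ (_ , inj₂ below) = ⊥-elim (0≢1+n (sym (trans below (row-window (# 0) (# 0)))))
  ... | inj₂ (same , inj₁ right) =
        (# 1 , # 0) , placed (trans right (cong suc (col-window (# 0) (# 0)))) (trans same (row-window (# 0) (# 0)))
  ... | inj₂ (_ , inj₂ left) = ⊥-elim (0≢1+n (sym (trans left (col-window (# 0) (# 0)))))

module _ {x : ℕ} (fits : 3 + x ≤ n) (hm : 2 ≤ m) where
  open Window x 0 fits hm

  side-full : Embedding.FullAt window (# 1 , # 0)
  side-full u adj with neighbour {u = u} adj
  ... | inj₁ (same , inj₁ above) =
        (# 1 , # 1) , placed (trans same (col-window (# 1) (# 0))) (trans above (cong suc (row-window (# 1) (# 0))))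
  ... | inj₁ (_ , inj₂ below) = ⊥-elim (0≢1+n (sym (trans below (row-window (# 1) (# 0)))))
  ... | inj₂ (same , inj₁ right) =
        (# 2 , # 0) , placed (trans right (cong suc (col-window (# 1) (# 0)))) (trans same (row-window (# 1) (# 0)))
  ... | inj₂ (same , inj₂ left) =
        (# 0 , # 0) , placed (suc-injective (trans left (col-window (# 1) (# 0)))) (trans same (row-window (# 1) (# 0)))

-- Every vertex of the bottom row has an escape route: the corner, its neighbour
-- (by transposing the corner window) and the vertices further along the side.
bottom-route : 2 ≤ m → 2 ≤ n → (v : Vertex m n) → row v ≡ 0 → EscapeRoute 5 v
bottom-route hm hn (i , j) j≡0 with toℕ i in i≡
... | 0 = subst (EscapeRoute 5) (sym (placed i≡ j≡0))
                (transfer window corner-route (corner-full hn hm))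
  where open Window 0 0 hn hm
... | 1 = subst (EscapeRoute 5) (sym (placed i≡ j≡0))
                (transfer window (along transpose transpose-onto corner-neighbour-route) (corner-full hn hm))
  where open Window 0 0 hn hm
... | suc (suc x) = subst (EscapeRoute 5) (sym (placed i≡ j≡0))
                          (transfer window side-route (side-full fits hm))
  where
  fits : 3 + x ≤ _
  fits = subst (λ c → suc c ≤ _) i≡ (toℕ<n i)
  open Window x 0 fits hm

mirror-top : (v : Vertex m n) → suc (row v) ≡ m → row (ι mirror v) ≡ 0
mirror-top {m} (i , j) top = trans (opposite-prop j) (trans (cong (m ∸_) top) (n∸n≡0 m))

horizontal-route : 2 ≤ m → 2 ≤ n → (v : Vertex m n) → row v ≡ 0 ⊎ suc (row v) ≡ m → EscapeRoute 5 v
horizontal-route hm hn v (inj₁ bottom) = bottom-route hm hn v bottom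
horizontal-route hm hn v (inj₂ top) =
  subst (EscapeRoute 5) (mirror-involutive v)
        (along mirror mirror-onto (bottom-route hm hn (ι mirror v) (mirror-top v top)))

boundary-route : 2 ≤ m → 2 ≤ n → (v : Vertex m n) →
  (row v ≡ 0 ⊎ suc (row v) ≡ m) ⊎ (col v ≡ 0 ⊎ suc (col v) ≡ n) → EscapeRoute 5 v
boundary-route hm hn v (inj₁ horizontal) = horizontal-route hm hn v horizontal
boundary-route hm hn v (inj₂ vertical) =
  along transpose transpose-onto (horizontal-route hn hm (ι transpose v) vertical)

all-vertices : (u : Vertex m n) → u ∈ vertices m n
all-vertices {m} (i , j) =
  ∈-concatMap⁺ (λ i → Data.List.map (i ,_) (allFin m)) (Any.map (λ { refl → ∈-map⁺ (i ,_) (∈-allFin j) }) (∈-allFin i))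

distinct-neighbours : ∀ {w : Vertex m n} (e : Fin k → Vertex m n) →
  Injective _≡_ _≡_ e → (∀ a → Adj w (e a)) → k ≤ degree w
distinct-neighbours {m} {n} {w = w} e e-injective adj = injective⇒≤ index-injective
  where
  listed : ∀ a → e a ∈ filter (adj? w) (vertices m n)
  listed a = ∈-filter⁺ (adj? w) (all-vertices (e a)) (adj a)
  index-injective : Injective _≡_ _≡_ (λ a → Any.index (listed a))
  index-injective {a} {b} same = e-injective (trans (lookup-index (listed a))
    (trans (cong (lookup (filter (adj? w) (vertices m n))) same) (sym (lookup-index (listed b)))))

-- The four neighbours of the centre of G_{3,3}; their direction can be read off.
compass : Fin 4 → Vertex 3 3
compass fz = # 0 , # 1
compass (fs fz) = # 2 , # 1
compass (fs (fs fz)) = # 1 , # 0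
compass (fs (fs (fs fz))) = # 1 , # 2

direction : Vertex 3 3 → Fin 4
direction (fz , _) = # 0
direction (fs (fs fz) , _) = # 1
direction (fs fz , fz) = # 2
direction (fs fz , _) = # 3

compass-injective : Injective _≡_ _≡_ compass
compass-injective {a} {b} same = trans (sym (direction-compass a)) (trans (cong direction same) (direction-compass b))
  where
  direction-compass : ∀ a → direction (compass a) ≡ a
  direction-compass fz = refl
  direction-compass (fs fz) = refl
  direction-compass (fs (fs fz)) = refl
  direction-compass (fs (fs (fs fz))) = refl

compass-adjacent : ∀ a → Adj (# 1 , # 1) (compass a)
compass-adjacent fz = refl
compass-adjacent (fs fz) = refl
compass-adjacent (fs (fs fz)) = refl
compass-adjacent (fs (fs (fs fz))) = refl

-- An interior vertex is the centre of a G_{3,3} window, so it has degree 4.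
interior-degree : ∀ {x y} (v : Vertex m n) → col v ≡ suc x → 3 + x ≤ n → row v ≡ suc y → 3 + y ≤ m →
  4 ≤ degree v
interior-degree {x = x} {y} v cv fits-col rv fits-row =
  subst (λ w → 4 ≤ degree w) (sym (placed cv rv))
    (distinct-neighbours {w = ι window (# 1 , # 1)} (ι window ∘ compass) (compass-injective ∘ Embedding.injective window)
                         (λ a → Embedding.adj⁺ window {# 1 , # 1} {compass a} (compass-adjacent a)))
  where open Window x y fits-col fits-row

inner : ∀ {N} a → a < N → a ≢ 0 → suc a ≢ N → ∃[ x ] (a ≡ suc x × 3 + x ≤ N)
inner zero _ a≢0 _ = ⊥-elim (a≢0 refl)
inner (suc x) a<N _ a+1≢N = x , refl , ≤∧≢⇒< a<N a+1≢N

on-boundary : (v : Vertex m n) → degree v < 4 →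
  (row v ≡ 0 ⊎ suc (row v) ≡ m) ⊎ (col v ≡ 0 ⊎ suc (col v) ≡ n)
on-boundary {m} {n} v small with row v ≟ 0 | suc (row v) ≟ m | col v ≟ 0 | suc (col v) ≟ n
... | yes bottom | _ | _ | _ = inj₁ (inj₁ bottom)
... | no _ | yes top | _ | _ = inj₁ (inj₂ top)
... | no _ | no _ | yes left | _ = inj₂ (inj₁ left)
... | no _ | no _ | no _ | yes right = inj₂ (inj₂ right)
... | no r≢0 | no r≢m | no c≢0 | no c≢n
  with inner (col v) (toℕ<n _) c≢0 c≢n | inner (row v) (toℕ<n _) r≢0 r≢m
... | x , cv , fits-col | y , rv , fits-row = ⊥-elim (<⇒≱ small (interior-degree v cv fits-col rv fits-row))

lemma4p10 : (m n k : ℕ) → 2 ≤ m → 2 ≤ n → (c₀ : Fin k → Vertex m n) →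
    ∃[ v ] ((degree v ≡ 2 ⊎ degree v ≡ 3) × (∀ i → ¬ Within 5 (c₀ i) v)) →
    RobberWins c₀
lemma4p10 m n k hm hn c₀ (v , deg , far) =
  escape-wins (boundary-route hm hn v (on-boundary v (below-4 deg))) c₀ far
  where
  below-4 : degree v ≡ 2 ⊎ degree v ≡ 3 → degree v < 4
  below-4 (inj₁ two) rewrite two = s≤s (s≤s (s≤s z≤n))
  below-4 (inj₂ three) rewrite three = s≤s (s≤s (s≤s (s≤s z≤n)))
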